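{- Let $K$ be a $^*$-continuous KAT with top, $A$ a top Kleene abstract domain of $K$ with maps $\alpha,\gamma$, and $T_{\Sigma,B}$ a KAT language interpreted on $K$. For all $a,b\in K$ and $t\in T_{\Sigma,B}$, if $[a]\,t\,[b]$ is derivable in the proof system $\mathrm{LCTK}_A$, then (i) $\top b\le\top a\llbracket t\rrbracket_u$, and (ii) $\mathcal S^\sharp[t]\,\alpha(\top a)=\alpha(\top b)=\alpha(\top a\llbracket t\rrbracket_u)$.
   Context: Idempotent semiring: $(K,+,0)$ commutative monoid with $a+a=a$, $(K,\cdot,1)$ monoid, two-sided distributivity, $0a=a0=0$; $a\le b$ iff $a+b=b$. KAT: idempotent semiring with Boolean subalgebra $\mathrm{Test}(K)$ (join $+$, meet $\cdot$, complement, bottom $0$, top $1$) and ${}^*$ with $1+aa^*\le a^*$, $1+a^*a\le a^*$, $b+ac\le c\Rightarrow a^*b\le c$, $b+ca\le c\Rightarrow ba^*\le c$. TopKAT: KAT with a greatest element $\top$; $^*$-continuous: for all $a,b,c$, $\bigvee_nab^nc$ exists and equals $ab^*c$. $\mathrm{TOP}(K)=\{\top a\mid a\in K\}$. Language: disjoint $\Sigma,B$ ($\mathtt0,\mathtt1\in B$), $\mathrm{Atom}=\Sigma\cup B$, terms $t::=\mathtt a\mid\mathtt0\mid\mathtt1\mid t_1+t_2\mid t_1\cdot t_2\mid t^*$; evaluation $u:\mathrm{Atom}\to K$ with $u(B)\subseteq\mathrm{Test}(K)$, extended homomorphically to $\llbracket\cdot\rrbracket_u$. Top Kleene abstract domain: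 poset $A$, Galois insertion $\alpha:\mathrm{TOP}(K)\to A$, $\gamma:A\to\mathrm{TOP}(K)$ ($\alpha(x)\le_Ay\iff x\le\gamma(y)$, $\alpha\gamma=\mathrm{id}$), countably complete. Abstract semantics: $\mathcal S^\sharp[\mathtt c]x=\alpha(\gamma(x)\llbracket\mathtt c\rrbracket_u)$, $\mathcal S^\sharp[t_1+t_2]x=\mathcal S^\sharp[t_1]x\vee_A\mathcal S^\sharp[t_2]x$, $\mathcal S^\sharp[t_1\cdot t_2]x=\mathcal S^\sharp[t_2](\mathcal S^\sharp[t_1]x)$, $\mathcal S^\sharp[t^*]x=\bigvee_n(\mathcal S^\sharp[t])^nx$. For $x\in\mathrm{TOP}(K)$, $A(x):=\gamma(\alpha(x))$. For $c,b\in K$, $A$ is locally complete for $c$ on $b$, written $\mathbb C^A_b(c)$, iff $A(\top bc)=A(A(\top b)c)$. $\mathrm{LCTK}_A$ rules (triples $[a]t[b]$, $a,b\in K$): (transfer) $\mathtt c\in\mathrm{Atom}$, $\mathbb C^A_a(\llbracket\mathtt c\rrbracket_u)$ $\vdash[a]\mathtt c[a\llbracket\mathtt c\rrbracket_u]$; (relax) $\top a'\le\top a\le A(\top a')$, $[a']t[b']$, $\top b\le\top b'\le A(\top b)$ $\vdash[a]t[b]$; (seq) $[a]t_1[r]$, $[r]t_2[b]$ $\vdash[a]t_1\cdot t_2[b]$; (join) $[a]t_1[b_1]$, $[a]t_2[b_2]$ $\vdash[a]t_1+t_2[b_1+b_2]$; (rec) $[a]t[r]$, $[a+r]t^*[b]$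 $\vdash[a]t^*[b]$; (iterate) $[a]t[b]$, $\top b\le A(\top a)$ $\vdash[a]t^*[a+b]$. -}

module Defs where

open import Data.Nat using (ℕ; zero; suc)
open import Data.Product using (Σ; ∃; _×_; _,_; proj₁)
open import Data.Sum using (_⊎_; inj₁; inj₂)
open import Relation.Binary.PropositionalEquality using (_≡_; refl)

Leq : {C : Set} → (C → C → C) → C → C → Set
Leq _+_ a b = a + b ≡ b

record TopKAT : Set₁ where
  infixl 6 _+_
  infixl 7 _·_
  infix  8 _⋆
  field
    Carrier : Set
    _+_ _·_ : Carrier → Carrier → Carrier
    0# 1#   : Carrier
    _⋆      : Carrier → Carrier
    ⊤       : Carrier
    +-assoc     : ∀ a b c → (a + b) + c ≡ a + (b + c)
    +-comm      : ∀ a b → a + b ≡ b + a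
    +-identityˡ : ∀ a → 0# + a ≡ a
    +-idem      : ∀ a → a + a ≡ a
    ·-assoc     : ∀ a b c → (a · b) · c ≡ a · (b · c)
    ·-identityˡ : ∀ a → 1# · a ≡ a
    ·-identityʳ : ∀ a → a · 1# ≡ a
    distribˡ    : ∀ a b c → a · (b + c) ≡ a · b + a · c
    distribʳ    : ∀ a b c → (b + c) · a ≡ b · a + c · a
    zeroˡ       : ∀ a → 0# · a ≡ 0#
    zeroʳ       : ∀ a → a · 0# ≡ 0#
    IsTest      : Carrier → Set
    ¬_          : Carrier → Carrier
    test-0      : IsTest 0#
    test-1      : IsTest 1#
    test-+      : ∀ {b c} → IsTest b → IsTest c → IsTest (b + c)
    test-·      : ∀ {b c} → IsTest b → IsTest c → IsTest (b · c)
    test-¬      : ∀ {b} → IsTest b → IsTest (¬ b)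
    -- Boolean algebra laws on tests (Huntington: the remaining ones
    -- (commutativity/identity of +, identity of ·, distributivity of ·
    -- over +) are already semiring laws)
    test-·-comm : ∀ {b c} → IsTest b → IsTest c → b · c ≡ c · b
    test-+-distrib-· : ∀ {b c d} → IsTest b → IsTest c → IsTest d →
                       b + c · d ≡ (b + c) · (b + d)
    test-compl-+ : ∀ {b} → IsTest b → b + ¬ b ≡ 1#
    test-compl-· : ∀ {b} → IsTest b → b · ¬ b ≡ 0#
    star-unfoldˡ : ∀ a → Leq _+_ (1# + a · a ⋆) (a ⋆)
    star-unfoldʳ : ∀ a → Leq _+_ (1# + a ⋆ · a) (a ⋆)
    star-indˡ    : ∀ a b c → Leq _+_ (b + a · c) c → Leq _+_ (a ⋆ · b) c
    star-indʳ    : ∀ a b c → Leq _+_ (b + c · a) c → Leq _+_ (b · a ⋆) c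
    ⊤-max        : ∀ a → Leq _+_ a ⊤

  infix 4 _≤_
  _≤_ : Carrier → Carrier → Set
  _≤_ = Leq _+_

  _^_ : Carrier → ℕ → Carrier
  b ^ zero  = 1#
  b ^ suc n = (b ^ n) · b

  TOP : Set
  TOP = Σ Carrier (λ x → ∃ λ a → x ≡ ⊤ · a)

  top : Carrier → TOP
  top a = ⊤ · a , a , refl

  _·ᵀ_ : TOP → Carrier → TOP
  (x , a , _) ·ᵀ c = ⊤ · (a · c) , a · c , refl
  -- NB: by the stored equation x ≡ ⊤ · a and associativity, ⊤ · (a · c) = x · c.

record StarContinuousTopKAT : Set₁ where
  field
    kat : TopKAT
  open TopKAT kat
  field
    star-continuous-ub  : ∀ a b c n → a · (b ^ n) · c ≤ a · b ⋆ · c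
    star-continuous-lub : ∀ a b c d → (∀ n → a · (b ^ n) · c ≤ d) → a · b ⋆ · c ≤ d
  open TopKAT kat public

record TopKleeneAbstractDomain (K : StarContinuousTopKAT) : Set₁ where
  open StarContinuousTopKAT K
  infix 4 _⊑_
  field
    Abs       : Set
    _⊑_       : Abs → Abs → Set
    ⊑-refl    : ∀ x → x ⊑ x
    ⊑-trans   : ∀ {x y z} → x ⊑ y → y ⊑ z → x ⊑ z
    ⊑-antisym : ∀ {x y} → x ⊑ y → y ⊑ x → x ≡ y
    α         : TOP → Abs
    γ         : Abs → TOP
    galois    : ∀ (x : TOP) (y : Abs) → (α x ⊑ y → proj₁ x ≤ proj₁ (γ y))
                                       × (proj₁ x ≤ proj₁ (γ y) → α x ⊑ y)
    αγ≡id     : ∀ y → α (γ y) ≡ y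
    -- countably complete: every countable subset (empty, or the range of a
    -- sequence ℕ → A) has a least upper bound
    ⊥A        : Abs
    ⊥A-least  : ∀ y → ⊥A ⊑ y
    ⋁         : (ℕ → Abs) → Abs
    ⋁-ub      : ∀ (f : ℕ → Abs) n → f n ⊑ ⋁ f
    ⋁-lub     : ∀ (f : ℕ → Abs) y → (∀ n → f n ⊑ y) → ⋁ f ⊑ y

  _∨A_ : Abs → Abs → Abs
  x ∨A y = ⋁ (λ { zero → x ; (suc _) → y })

  𝒜 : TOP → Carrier
  𝒜 x = proj₁ (γ (α x))

  LocallyComplete : Carrier → Carrier → Set
  LocallyComplete b c = 𝒜 (top (b · c)) ≡ 𝒜 (γ (α (top b)) ·ᵀ c)

record Language : Set₁ where
  field
    Sig : Set
    Bool-atoms : Set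
    𝟘 𝟙 : Bool-atoms

  Atom : Set
  Atom = Sig ⊎ Bool-atoms

  data Term : Set where
    atom : Atom → Term
    _⊕_  : Term → Term → Term
    _⊙_  : Term → Term → Term
    _✶   : Term → Term

  𝟎 𝟏 : Term
  𝟎 = atom (inj₂ 𝟘)
  𝟏 = atom (inj₂ 𝟙)

record Interpretation (K : StarContinuousTopKAT) (L : Language) : Set where
  open StarContinuousTopKAT K
  open Language L
  field
    u      : Atom → Carrier
    u-test : ∀ b → IsTest (u (inj₂ b))
    u-𝟘    : u (inj₂ 𝟘) ≡ 0#
    u-𝟙    : u (inj₂ 𝟙) ≡ 1#

module Semantics (K : StarContinuousTopKAT) (D : TopKleeneAbstractDomain K)
                 (L : Language) (I : Interpretation K L) where
  open StarContinuousTopKAT K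
  open TopKleeneAbstractDomain D
  open Language L
  open Interpretation I

  ⟦_⟧ : Term → Carrier
  ⟦ atom c ⟧  = u c
  ⟦ t₁ ⊕ t₂ ⟧ = ⟦ t₁ ⟧ + ⟦ t₂ ⟧
  ⟦ t₁ ⊙ t₂ ⟧ = ⟦ t₁ ⟧ · ⟦ t₂ ⟧
  ⟦ t ✶ ⟧     = ⟦ t ⟧ ⋆

  iter : ℕ → (Abs → Abs) → Abs → Abs
  iter zero    f x = x
  iter (suc n) f x = f (iter n f x)

  S♯ : Term → Abs → Abs
  S♯ (atom c)  x = α (γ x ·ᵀ u c)
  S♯ (t₁ ⊕ t₂) x = S♯ t₁ x ∨A S♯ t₂ x
  S♯ (t₁ ⊙ t₂) x = S♯ t₂ (S♯ t₁ x)
  S♯ (t ✶)     x = ⋁ (λ n → iter n (S♯ t) x)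

  data ⊢[_]_[_] : Carrier → Term → Carrier → Set where
    transfer : ∀ {a} (c : Atom) → LocallyComplete a (u c) →
               ⊢[ a ] atom c [ a · u c ]
    relax    : ∀ {a a' b b' t} →
               ⊤ · a' ≤ ⊤ · a → ⊤ · a ≤ 𝒜 (top a') →
               ⊢[ a' ] t [ b' ] →
               ⊤ · b ≤ ⊤ · b' → ⊤ · b' ≤ 𝒜 (top b) →
               ⊢[ a ] t [ b ]
    seq      : ∀ {a r b t₁ t₂} → ⊢[ a ] t₁ [ r ] → ⊢[ r ] t₂ [ b ] →
               ⊢[ a ] t₁ ⊙ t₂ [ b ]
    join     : ∀ {a b₁ b₂ t₁ t₂} → ⊢[ a ] t₁ [ b₁ ] → ⊢[ a ] t₂ [ b₂ ] →
               ⊢[ a ] t₁ ⊕ t₂ [ b₁ + b₂ ]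
    rec      : ∀ {a r b t} → ⊢[ a ] t [ r ] → ⊢[ a + r ] t ✶ [ b ] →
               ⊢[ a ] t ✶ [ b ]
    iterate  : ∀ {a b t} → ⊢[ a ] t [ b ] → ⊤ · b ≤ 𝒜 (top a) →
               ⊢[ a ] t ✶ [ a + b ]

{-# OPTIONS --safe #-}
-- Part (i) and the inclusion S♯ t (α ⊤a) ⊑ α ⊤b follow by induction on the
-- derivation; the reverse inclusions come from soundness of the
-- abstract semantics, α ⊤a⟦t⟧ ⊑ S♯ t (α ⊤a), which holds for every term by
-- *-continuity.  The three inclusions form the cycle
-- α ⊤b ⊑ α ⊤a⟦t⟧ ⊑ S♯ t (α ⊤a) ⊑ α ⊤b, so all three values coincide.
module Submission where

open import Defs
open import Data.Nat using (zero; suc)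
open import Data.Product using (_×_; _,_; proj₁; proj₂)
open import Relation.Binary.Bundles using (Poset)
open import Relation.Binary.PropositionalEquality
  using (_≡_; refl; sym; trans; cong; subst; isEquivalence; module ≡-Reasoning)
import Relation.Binary.Reasoning.PartialOrder as PosetReasoning

module TopKATProperties (K : TopKAT) where
  open TopKAT K

  ≤-reflexive : ∀ {a b} → a ≡ b → a ≤ b
  ≤-reflexive {a} refl = +-idem a

  ≤-trans : ∀ {a b c} → a ≤ b → b ≤ c → a ≤ c
  ≤-trans {a} {b} {c} a≤b b≤c = begin
    a + c        ≡⟨ cong (a +_) b≤c ⟨
    a + (b + c)  ≡⟨ +-assoc a b c ⟨
    (a + b) + c  ≡⟨ cong (_+ c) a≤b ⟩
    b + c        ≡⟨ b≤c ⟩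
    c            ∎
    where open ≡-Reasoning

  ≤-antisym : ∀ {a b} → a ≤ b → b ≤ a → a ≡ b
  ≤-antisym {a} {b} a≤b b≤a = trans (sym b≤a) (trans (+-comm b a) a≤b)

  ≤-poset : Poset _ _ _
  ≤-poset = record
    { isPartialOrder = record
      { isPreorder = record
        { isEquivalence = isEquivalence
        ; reflexive     = ≤-reflexive
        ; trans         = ≤-trans
        }
      ; antisym = ≤-antisym
      }
    }

  +-least : ∀ {a b c} → a ≤ c → b ≤ c → a + b ≤ c
  +-least {a} {b} {c} a≤c b≤c = trans (+-assoc a b c) (trans (cong (a +_) b≤c) a≤c)

  x≤x+y : ∀ a b → a ≤ a + b
  x≤x+y a b = trans (sym (+-assoc a a b)) (cong (_+ b) (+-idem a))

  y≤x+y : ∀ a b → b ≤ a + b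
  y≤x+y a b = trans (cong (b +_) (+-comm a b)) (trans (x≤x+y b a) (+-comm b a))

  +-mono-≤ : ∀ {a a' b b'} → a ≤ a' → b ≤ b' → a + b ≤ a' + b'
  +-mono-≤ {a} {a'} {b} {b'} a≤a' b≤b' =
    +-least (≤-trans a≤a' (x≤x+y a' b')) (≤-trans b≤b' (y≤x+y a' b'))

  ·-monoˡ-≤ : ∀ {a b} c → a ≤ b → a · c ≤ b · c
  ·-monoˡ-≤ {a} {b} c a≤b = trans (sym (distribʳ c a b)) (cong (_· c) a≤b)

  ·-monoʳ-≤ : ∀ {a b} c → a ≤ b → c · a ≤ c · b
  ·-monoʳ-≤ {a} {b} c a≤b = trans (sym (distribˡ c a b)) (cong (c ·_) a≤b)

  1≤a⋆ : ∀ a → 1# ≤ a ⋆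
  1≤a⋆ a = ≤-trans (x≤x+y 1# (a · a ⋆)) (star-unfoldˡ a)

  a·a⋆≤a⋆ : ∀ a → a · a ⋆ ≤ a ⋆
  a·a⋆≤a⋆ a = ≤-trans (y≤x+y 1# (a · a ⋆)) (star-unfoldˡ a)

  a≤a⋆ : ∀ a → a ≤ a ⋆
  a≤a⋆ a = ≤-trans (≤-reflexive (sym (·-identityʳ a)))
                   (≤-trans (·-monoʳ-≤ a (1≤a⋆ a)) (a·a⋆≤a⋆ a))

  ·ᵀ-carrier : ∀ (x : TOP) c → proj₁ (x ·ᵀ c) ≡ proj₁ x · c
  ·ᵀ-carrier (x , a , x≡⊤a) c = trans (sym (·-assoc ⊤ a c)) (cong (_· c) (sym x≡⊤a))

module AbstractDomainProperties (K : StarContinuousTopKAT) (D : TopKleeneAbstractDomain K) where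
  open StarContinuousTopKAT K
  open TopKleeneAbstractDomain D
  open TopKATProperties kat

  α⊑⇒≤γ : ∀ {x y} → α x ⊑ y → proj₁ x ≤ proj₁ (γ y)
  α⊑⇒≤γ {x} {y} = proj₁ (galois x y)

  ≤γ⇒α⊑ : ∀ {x y} → proj₁ x ≤ proj₁ (γ y) → α x ⊑ y
  ≤γ⇒α⊑ {x} {y} = proj₂ (galois x y)

  𝒜-extensive : ∀ x → proj₁ x ≤ 𝒜 x
  𝒜-extensive x = α⊑⇒≤γ (⊑-refl (α x))

  α-mono : ∀ {x x'} → proj₁ x ≤ proj₁ x' → α x ⊑ α x'
  α-mono {x' = x'} x≤x' = ≤γ⇒α⊑ (≤-trans x≤x' (𝒜-extensive x'))

  γ-mono : ∀ {y y'} → y ⊑ y' → proj₁ (γ y) ≤ proj₁ (γ y')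
  γ-mono {y} {y'} y⊑y' = α⊑⇒≤γ (subst (_⊑ y') (sym (αγ≡id y)) y⊑y')

  α-constant-between : ∀ {x x'} → proj₁ x' ≤ proj₁ x → proj₁ x ≤ 𝒜 x' → α x ≡ α x'
  α-constant-between x'≤x x≤𝒜x' = ⊑-antisym (≤γ⇒α⊑ x≤𝒜x') (α-mono x'≤x)

  x⊑x∨y : ∀ {x y} → x ⊑ x ∨A y
  x⊑x∨y = ⋁-ub _ zero

  y⊑x∨y : ∀ {x y} → y ⊑ x ∨A y
  y⊑x∨y = ⋁-ub _ (suc zero)

  ∨-least : ∀ {x y z} → x ⊑ z → y ⊑ z → x ∨A y ⊑ z
  ∨-least {z = z} x⊑z y⊑z = ⋁-lub _ z λ { zero → x⊑z ; (suc _) → y⊑z }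

module AbstractSemanticsProperties (K : StarContinuousTopKAT) (D : TopKleeneAbstractDomain K)
                                   (L : Language) (I : Interpretation K L) where
  open StarContinuousTopKAT K
  open TopKleeneAbstractDomain D
  open Language L
  open Interpretation I
  open Semantics K D L I
  open TopKATProperties kat
  open AbstractDomainProperties K D
  open PosetReasoning ≤-poset

  Monotone : (Abs → Abs) → Set
  Monotone F = ∀ {y y'} → y ⊑ y' → F y ⊑ F y'

  iter-mono : ∀ {F} → Monotone F → ∀ n → Monotone (iter n F)
  iter-mono F-mono zero    y⊑y' = y⊑y'
  iter-mono F-mono (suc n) y⊑y' = F-mono (iter-mono F-mono n y⊑y')

  iter-prefixed : ∀ {F x} → Monotone F → F x ⊑ x → ∀ n → iter n F x ⊑ x
  iter-prefixed F-mono Fx⊑x zero    = ⊑-refl _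
  iter-prefixed F-mono Fx⊑x (suc n) = ⊑-trans (F-mono (iter-prefixed F-mono Fx⊑x n)) Fx⊑x

  S♯-mono : ∀ t → Monotone (S♯ t)
  S♯-mono (atom c)  {y} {y'} y⊑y' = α-mono (begin
    proj₁ (γ y ·ᵀ u c)   ≡⟨ ·ᵀ-carrier (γ y) (u c) ⟩
    proj₁ (γ y) · u c    ≤⟨ ·-monoˡ-≤ (u c) (γ-mono y⊑y') ⟩
    proj₁ (γ y') · u c   ≡⟨ ·ᵀ-carrier (γ y') (u c) ⟨
    proj₁ (γ y' ·ᵀ u c)  ∎)
  S♯-mono (t₁ ⊕ t₂) y⊑y' = ∨-least (⊑-trans (S♯-mono t₁ y⊑y') x⊑x∨y)
                                   (⊑-trans (S♯-mono t₂ y⊑y') y⊑x∨y)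
  S♯-mono (t₁ ⊙ t₂) y⊑y' = S♯-mono t₂ (S♯-mono t₁ y⊑y')
  S♯-mono (t ✶)     y⊑y' =
    ⋁-lub _ _ (λ n → ⊑-trans (iter-mono (S♯-mono t) n y⊑y') (⋁-ub _ n))

  Sound : Term → Set
  Sound t = ∀ x y → x ≤ proj₁ (γ y) → x · ⟦ t ⟧ ≤ proj₁ (γ (S♯ t y))

  iter-sound : ∀ t → Sound t → ∀ n x y → x ≤ proj₁ (γ y) →
               x · (⟦ t ⟧ ^ n) ≤ proj₁ (γ (iter n (S♯ t) y))
  iter-sound t s zero    x y x≤γy = ≤-trans (≤-reflexive (·-identityʳ x)) x≤γy
  iter-sound t s (suc n) x y x≤γy = begin
    x · (⟦ t ⟧ ^ n · ⟦ t ⟧)  ≡⟨ ·-assoc x (⟦ t ⟧ ^ n) ⟦ t ⟧ ⟨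
    x · ⟦ t ⟧ ^ n · ⟦ t ⟧    ≤⟨ s _ _ (iter-sound t s n x y x≤γy) ⟩
    proj₁ (γ (iter (suc n) (S♯ t) y)) ∎

  S♯-sound : ∀ t → Sound t
  S♯-sound (atom c) x y x≤γy = begin
    x · u c              ≤⟨ ·-monoˡ-≤ (u c) x≤γy ⟩
    proj₁ (γ y) · u c    ≡⟨ ·ᵀ-carrier (γ y) (u c) ⟨
    proj₁ (γ y ·ᵀ u c)   ≤⟨ 𝒜-extensive (γ y ·ᵀ u c) ⟩
    proj₁ (γ (S♯ (atom c) y)) ∎
  S♯-sound (t₁ ⊕ t₂) x y x≤γy = begin
    x · (⟦ t₁ ⟧ + ⟦ t₂ ⟧)    ≡⟨ distribˡ x ⟦ t₁ ⟧ ⟦ t₂ ⟧ ⟩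
    x · ⟦ t₁ ⟧ + x · ⟦ t₂ ⟧  ≤⟨ +-least (≤-trans (S♯-sound t₁ x y x≤γy) (γ-mono x⊑x∨y))
                                        (≤-trans (S♯-sound t₂ x y x≤γy) (γ-mono y⊑x∨y)) ⟩
    proj₁ (γ (S♯ (t₁ ⊕ t₂) y)) ∎
  S♯-sound (t₁ ⊙ t₂) x y x≤γy = begin
    x · (⟦ t₁ ⟧ · ⟦ t₂ ⟧)  ≡⟨ ·-assoc x ⟦ t₁ ⟧ ⟦ t₂ ⟧ ⟨
    x · ⟦ t₁ ⟧ · ⟦ t₂ ⟧    ≤⟨ S♯-sound t₂ _ _ (S♯-sound t₁ x y x≤γy) ⟩
    proj₁ (γ (S♯ (t₁ ⊙ t₂) y)) ∎
  S♯-sound (t ✶) x y x≤γy = begin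
    x · ⟦ t ⟧ ⋆         ≡⟨ ·-identityʳ _ ⟨
    x · ⟦ t ⟧ ⋆ · 1#    ≤⟨ star-continuous-lub x ⟦ t ⟧ 1# _ iterate-below ⟩
    proj₁ (γ (S♯ (t ✶) y)) ∎
    where
    iterate-below : ∀ n → x · ⟦ t ⟧ ^ n · 1# ≤ proj₁ (γ (S♯ (t ✶) y))
    iterate-below n = begin
      x · ⟦ t ⟧ ^ n · 1#                  ≡⟨ ·-identityʳ _ ⟩
      x · ⟦ t ⟧ ^ n                       ≤⟨ iter-sound t (S♯-sound t) n x y x≤γy ⟩
      proj₁ (γ (iter n (S♯ t) y))         ≤⟨ γ-mono (⋁-ub _ n) ⟩
      proj₁ (γ (S♯ (t ✶) y))              ∎

  α-top-⟦⟧⊑S♯ : ∀ a t → α (top (a · ⟦ t ⟧)) ⊑ S♯ t (α (top a))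
  α-top-⟦⟧⊑S♯ a t = ≤γ⇒α⊑ (begin
    ⊤ · (a · ⟦ t ⟧)  ≡⟨ ·-assoc ⊤ a ⟦ t ⟧ ⟨
    ⊤ · a · ⟦ t ⟧    ≤⟨ S♯-sound t (⊤ · a) (α (top a)) (𝒜-extensive (top a)) ⟩
    proj₁ (γ (S♯ t (α (top a)))) ∎)

module LCTKProperties (K : StarContinuousTopKAT) (D : TopKleeneAbstractDomain K)
                      (L : Language) (I : Interpretation K L) where
  open StarContinuousTopKAT K
  open TopKleeneAbstractDomain D
  open Language L
  open Interpretation I
  open Semantics K D L I
  open TopKATProperties kat
  open AbstractDomainProperties K D
  open AbstractSemanticsProperties K D L I
  open PosetReasoning ≤-poset

  ⊤·x≤⊤·[x+y] : ∀ a b → ⊤ · a ≤ ⊤ · (a + b)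
  ⊤·x≤⊤·[x+y] a b = ·-monoʳ-≤ ⊤ (x≤x+y a b)

  ⊤·y≤⊤·[x+y] : ∀ a b → ⊤ · b ≤ ⊤ · (a + b)
  ⊤·y≤⊤·[x+y] a b = ·-monoʳ-≤ ⊤ (y≤x+y a b)

  derivable⇒under-approx : ∀ {a t b} → ⊢[ a ] t [ b ] → ⊤ · b ≤ ⊤ · a · ⟦ t ⟧
  derivable⇒under-approx {a} (transfer c _) = ≤-reflexive (sym (·-assoc ⊤ a (u c)))
  derivable⇒under-approx (relax {a} {a'} {b} {b'} {t} a'≤a _ d b≤b' _) = begin
    ⊤ · b           ≤⟨ b≤b' ⟩
    ⊤ · b'          ≤⟨ derivable⇒under-approx d ⟩
    ⊤ · a' · ⟦ t ⟧  ≤⟨ ·-monoˡ-≤ ⟦ t ⟧ a'≤a ⟩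
    ⊤ · a · ⟦ t ⟧   ∎
  derivable⇒under-approx (seq {a} {r} {b} {t₁} {t₂} d₁ d₂) = begin
    ⊤ · b                   ≤⟨ derivable⇒under-approx d₂ ⟩
    ⊤ · r · ⟦ t₂ ⟧          ≤⟨ ·-monoˡ-≤ ⟦ t₂ ⟧ (derivable⇒under-approx d₁) ⟩
    ⊤ · a · ⟦ t₁ ⟧ · ⟦ t₂ ⟧  ≡⟨ ·-assoc (⊤ · a) ⟦ t₁ ⟧ ⟦ t₂ ⟧ ⟩
    ⊤ · a · (⟦ t₁ ⟧ · ⟦ t₂ ⟧) ∎
  derivable⇒under-approx (join {a} {b₁} {b₂} {t₁} {t₂} d₁ d₂) = begin
    ⊤ · (b₁ + b₂)                    ≡⟨ distribˡ ⊤ b₁ b₂ ⟩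
    ⊤ · b₁ + ⊤ · b₂                  ≤⟨ +-mono-≤ (derivable⇒under-approx d₁)
                                                (derivable⇒under-approx d₂) ⟩
    ⊤ · a · ⟦ t₁ ⟧ + ⊤ · a · ⟦ t₂ ⟧  ≡⟨ distribˡ (⊤ · a) ⟦ t₁ ⟧ ⟦ t₂ ⟧ ⟨
    ⊤ · a · (⟦ t₁ ⟧ + ⟦ t₂ ⟧)        ∎
  derivable⇒under-approx (rec {a} {r} {b} {t} d₁ d₂) = begin
    ⊤ · b                              ≤⟨ derivable⇒under-approx d₂ ⟩
    ⊤ · (a + r) · ⟦ t ⟧ ⋆              ≡⟨ cong (_· ⟦ t ⟧ ⋆) (distribˡ ⊤ a r) ⟩
    (⊤ · a + ⊤ · r) · ⟦ t ⟧ ⋆          ≡⟨ distribʳ (⟦ t ⟧ ⋆) (⊤ · a) (⊤ · r) ⟩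
    ⊤ · a · ⟦ t ⟧ ⋆ + ⊤ · r · ⟦ t ⟧ ⋆  ≤⟨ +-least (≤-reflexive refl) ⊤r·t⋆≤⊤a·t⋆ ⟩
    ⊤ · a · ⟦ t ⟧ ⋆                    ∎
    where
    ⊤r·t⋆≤⊤a·t⋆ : ⊤ · r · ⟦ t ⟧ ⋆ ≤ ⊤ · a · ⟦ t ⟧ ⋆
    ⊤r·t⋆≤⊤a·t⋆ = begin
      ⊤ · r · ⟦ t ⟧ ⋆            ≤⟨ ·-monoˡ-≤ (⟦ t ⟧ ⋆) (derivable⇒under-approx d₁) ⟩
      ⊤ · a · ⟦ t ⟧ · ⟦ t ⟧ ⋆    ≡⟨ ·-assoc (⊤ · a) ⟦ t ⟧ (⟦ t ⟧ ⋆) ⟩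
      ⊤ · a · (⟦ t ⟧ · ⟦ t ⟧ ⋆)  ≤⟨ ·-monoʳ-≤ (⊤ · a) (a·a⋆≤a⋆ ⟦ t ⟧) ⟩
      ⊤ · a · ⟦ t ⟧ ⋆            ∎
  derivable⇒under-approx (iterate {a} {b} {t} d _) = begin
    ⊤ · (a + b)       ≡⟨ distribˡ ⊤ a b ⟩
    ⊤ · a + ⊤ · b     ≤⟨ +-least ⊤a≤⊤a·t⋆ ⊤b≤⊤a·t⋆ ⟩
    ⊤ · a · ⟦ t ⟧ ⋆   ∎
    where
    ⊤a≤⊤a·t⋆ : ⊤ · a ≤ ⊤ · a · ⟦ t ⟧ ⋆
    ⊤a≤⊤a·t⋆ = begin
      ⊤ · a            ≡⟨ ·-identityʳ (⊤ · a) ⟨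
      ⊤ · a · 1#       ≤⟨ ·-monoʳ-≤ (⊤ · a) (1≤a⋆ ⟦ t ⟧) ⟩
      ⊤ · a · ⟦ t ⟧ ⋆  ∎
    ⊤b≤⊤a·t⋆ : ⊤ · b ≤ ⊤ · a · ⟦ t ⟧ ⋆
    ⊤b≤⊤a·t⋆ = begin
      ⊤ · b            ≤⟨ derivable⇒under-approx d ⟩
      ⊤ · a · ⟦ t ⟧    ≤⟨ ·-monoʳ-≤ (⊤ · a) (a≤a⋆ ⟦ t ⟧) ⟩
      ⊤ · a · ⟦ t ⟧ ⋆  ∎

  derivable⇒S♯⊑ : ∀ {a t b} → ⊢[ a ] t [ b ] → S♯ t (α (top a)) ⊑ α (top b)
  derivable⇒S♯⊑ {a} (transfer c lc) =
    ≤γ⇒α⊑ (≤-trans (𝒜-extensive (γ (α (top a)) ·ᵀ u c)) (≤-reflexive (sym lc)))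
  derivable⇒S♯⊑ (relax {a} {a'} {b} {b'} {t} a'≤a a≤𝒜a' d _ b'≤𝒜b) =
    subst (λ x → S♯ t x ⊑ α (top b)) (sym (α-constant-between a'≤a a≤𝒜a'))
          (⊑-trans (derivable⇒S♯⊑ d) (≤γ⇒α⊑ b'≤𝒜b))
  derivable⇒S♯⊑ (seq {t₂ = t₂} d₁ d₂) =
    ⊑-trans (S♯-mono t₂ (derivable⇒S♯⊑ d₁)) (derivable⇒S♯⊑ d₂)
  derivable⇒S♯⊑ (join {b₁ = b₁} {b₂} d₁ d₂) =
    ∨-least (⊑-trans (derivable⇒S♯⊑ d₁) (α-mono (⊤·x≤⊤·[x+y] b₁ b₂)))
            (⊑-trans (derivable⇒S♯⊑ d₂) (α-mono (⊤·y≤⊤·[x+y] b₁ b₂)))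
  derivable⇒S♯⊑ (rec {a} {r} {t = t} _ d₂) =
    ⊑-trans (S♯-mono (t ✶) (α-mono (⊤·x≤⊤·[x+y] a r))) (derivable⇒S♯⊑ d₂)
  derivable⇒S♯⊑ (iterate {a} {b} {t} d b≤𝒜a) =
    ⋁-lub _ _ λ n → ⊑-trans (iter-prefixed (S♯-mono t) S♯αa⊑αa n)
                            (α-mono (⊤·x≤⊤·[x+y] a b))
    where
    S♯αa⊑αa : S♯ t (α (top a)) ⊑ α (top a)
    S♯αa⊑αa = ⊑-trans (derivable⇒S♯⊑ d) (≤γ⇒α⊑ b≤𝒜a)

theorem9 : (K : StarContinuousTopKAT) (D : TopKleeneAbstractDomain K)
           (L : Language) (I : Interpretation K L) →
           let open StarContinuousTopKAT K
               open TopKleeneAbstractDomain D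
               open Language L
               open Semantics K D L I
           in ∀ (a b : Carrier) (t : Term) →
              ⊢[ a ] t [ b ] →
              (⊤ · b ≤ ⊤ · a · ⟦ t ⟧)
              × (S♯ t (α (top a)) ≡ α (top b))
              × (α (top b) ≡ α (top (a · ⟦ t ⟧)))
theorem9 K D L I a b t d =
  under-approx ,
  ⊑-antisym S♯⊑αb (⊑-trans αb⊑αa⟦t⟧ αa⟦t⟧⊑S♯) ,
  ⊑-antisym αb⊑αa⟦t⟧ (⊑-trans αa⟦t⟧⊑S♯ S♯⊑αb)
  where
  open StarContinuousTopKAT K
  open TopKleeneAbstractDomain D
  open Semantics K D L I
  open TopKATProperties kat
  open AbstractDomainProperties K D
  open AbstractSemanticsProperties K D L I
  open LCTKProperties K D L I

  under-approx : ⊤ · b ≤ ⊤ · a · ⟦ t ⟧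
  under-approx = derivable⇒under-approx d

  αb⊑αa⟦t⟧ : α (top b) ⊑ α (top (a · ⟦ t ⟧))
  αb⊑αa⟦t⟧ = α-mono (≤-trans under-approx (≤-reflexive (·-assoc ⊤ a ⟦ t ⟧)))

  αa⟦t⟧⊑S♯ : α (top (a · ⟦ t ⟧)) ⊑ S♯ t (α (top a))
  αa⟦t⟧⊑S♯ = α-top-⟦⟧⊑S♯ a t

  S♯⊑αb : S♯ t (α (top a)) ⊑ α (top b)
  S♯⊑αb = derivable⇒S♯⊑ d
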